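{- Let $\mathcal{A}=\{A_1,\dots,A_r\}$ be a partition of $[n]$ with $|A_i|\ge2$, let $\mathcal{Q}=\bigcup_{1\le i<j\le r}\mathcal{Q}_{ij}$ be a complete $\mathcal{A}$-partite quartet system, let $\mathcal{F}$ be an $\mathcal{A}$-cut family, and let $R\subseteq[r]$ with $|R|\ge2$. If $\mathcal{Q}$ is displayed by $\mathcal{F}$, then $\mathcal{Q}_R$ is displayed by $\mathcal{F}_R$. Furthermore, if $\mathcal{Q}$ is compatible, then so is $\mathcal{Q}_R$.
   Context: Quartets $ab\|cd$ and $ab|cd$; a phylogenetic tree (tree with leaf set exactly the ground set, internal nodes of degree $\ge3$) displays $ab\|cd$ if the paths $a$–$b$, $c$–$d$ are disjoint, and $ab|cd$ if they share at most one node; a quartet system is compatible if some phylogenetic tree displays all its quartets. For disjoint $A,B$ with $|A|,|B|\ge2$, a system is complete bipartite relative to $\{A,B\}$ if for all distinct $a,a'\in A$, distinct $b,b'\in B$ exactly one of $ab\|a'b'$, $ab'\|a'b$, $aa'|bb'$ belongs to it and all its quartets have these forms; $\mathcal{Q}$ is complete $\mathcal{A}$-partite if $\mathcal{Q}=\bigcup_{i<j}\mathcal{Q}_{ij}$ with $\mathcal{Q}_{ij}$ complete bipartite relative to $\{A_i,A_j\}$. For $R\subseteq[r]$, $|R|\ge2$: $\mathcal{A}_R=\{A_i\}_{i\in R}$ (a partition of $A_R:=\bigcup_{i\in R}A_i$) and $\mathcal{Q}_R:=\bigcup_{i,j\in R,\,i<j}\mathcal{Q}_{ij}$ (a complete $\mathcal{A}_R$-partite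 system). A family $\mathcal{F}$ of subsets displays a complete $\mathcal{A}$-partite $\mathcal{Q}$ if for all distinct $i,j$, distinct $a,a'\in A_i$, distinct $b,b'\in A_j$: $ab\|a'b'\in\mathcal{Q}$ iff some $X\in\mathcal{F}$ has $a,b\in X\not\ni a',b'$ or $a,b\notin X\ni a',b'$ (analogously for $\mathcal{A}_R$). A set $X$ is an $\mathcal{A}$-cut if $\emptyset\ne X\cap A_i\ne A_i$ for at least two $i\in[r]$ (analogously $\mathcal{A}_R$-cut); an $\mathcal{A}$-cut family is a family of $\mathcal{A}$-cuts. $\mathcal{F}_R:=\{X\cap A_R: X\in\mathcal{F},\ X\cap A_R\text{ is an }\mathcal{A}_R\text{ -cut}\}$. -}

module Defs where

open import Data.Nat using (ℕ; _≤_)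
open import Data.Fin using (Fin; _<_)
open import Data.Fin.Subset using (Subset; _∈_; _∉_; _∩_; ∣_∣; ⊤)
open import Data.Fin.Subset.Properties using (_∈?_)
open import Data.Vec using (tabulate)
open import Data.List using (List; []; _∷_; length)
import Data.List.Membership.Propositional as LM
open import Data.List.Relation.Unary.Unique.Propositional using (Unique)
open import Data.Product using (Σ; ∃; ∃-syntax; _×_; _,_)
open import Data.Sum using (_⊎_)
open import Data.Empty using (⊥)
import Data.Unit as U
open import Relation.Nullary using (¬_; does)
open import Relation.Binary.PropositionalEquality using (_≡_; _≢_)

-- Partitions of [n] = Fin n into r blocks A_1..A_r, given by the block
-- index  part : Fin n → Fin r  (A_i = { a | part a ≡ i }).

BlocksAtLeast2 : ∀ {n r} → (Fin n → Fin r) → Set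
BlocksAtLeast2 {n} {r} part =
  (i : Fin r) → Σ (Fin n) λ a → Σ (Fin n) λ a' → a ≢ a' × part a ≡ i × part a' ≡ i

-- Quartets:  strong a b c d  is  ab‖cd ,  weak a b c d  is  ab|cd

data Quartet (n : ℕ) : Set where
  strong : Fin n → Fin n → Fin n → Fin n → Quartet n
  weak   : Fin n → Fin n → Fin n → Fin n → Quartet n

QuartetSystem : ℕ → Set₁
QuartetSystem n = Quartet n → Set

-- the 8 terms denoting the same (unordered) quartet
variants : ∀ {n} → Quartet n → List (Quartet n)
variants (strong a b c d) =
  strong a b c d ∷ strong b a c d ∷ strong a b d c ∷ strong b a d c ∷
  strong c d a b ∷ strong d c a b ∷ strong c d b a ∷ strong d c b a ∷ []
variants (weak a b c d) =
  weak a b c d ∷ weak b a c d ∷ weak a b d c ∷ weak b a d c ∷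
  weak c d a b ∷ weak d c a b ∷ weak c d b a ∷ weak d c b a ∷ []

_∈Q_ : ∀ {n} → Quartet n → QuartetSystem n → Set
q ∈Q 𝒬 = Σ _ λ q' → LM._∈_ q' (variants q) × 𝒬 q'

ExactlyOne3 : Set → Set → Set → Set
ExactlyOne3 P Q R = (P × ¬ Q × ¬ R) ⊎ (¬ P × Q × ¬ R) ⊎ (¬ P × ¬ Q × R)

CompleteBipartite : ∀ {n r} → (Fin n → Fin r) → Fin r → Fin r → QuartetSystem n → Set
CompleteBipartite {n} part i j 𝒬 =
  ((a a' b b' : Fin n) → part a ≡ i → part a' ≡ i → part b ≡ j → part b' ≡ j →
     a ≢ a' → b ≢ b' →
     ExactlyOne3 (strong a b a' b' ∈Q 𝒬) (strong a b' a' b ∈Q 𝒬) (weak a a' b b' ∈Q 𝒬))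
  × ((q : Quartet n) → 𝒬 q →
     Σ (Fin n) λ a → Σ (Fin n) λ a' → Σ (Fin n) λ b → Σ (Fin n) λ b' →
       part a ≡ i × part a' ≡ i × part b ≡ j × part b' ≡ j × a ≢ a' × b ≢ b' ×
       (LM._∈_ q (variants (strong a b a' b')) ⊎ LM._∈_ q (variants (strong a b' a' b))
         ⊎ LM._∈_ q (variants (weak a a' b b'))))

-- family (𝒬ᵢⱼ) with each 𝒬ᵢⱼ (i < j) complete bipartite: 𝒬 = ⋃_{i<j} 𝒬ᵢⱼ is complete 𝒜-partite
CompletePartiteFamily : ∀ {n r} → (Fin n → Fin r) → (Fin r → Fin r → QuartetSystem n) → Set
CompletePartiteFamily part 𝒬s = ∀ i j → i < j → CompleteBipartite part i j (𝒬s i j)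

-- 𝒬_R = ⋃_{i,j ∈ R, i<j} 𝒬ᵢⱼ ;  the full 𝒬 is 𝒬_[r] = UnionOn ⊤ 𝒬s
UnionOn : ∀ {n r} → Subset r → (Fin r → Fin r → QuartetSystem n) → QuartetSystem n
UnionOn {r = r} R 𝒬s q = Σ (Fin r) λ i → Σ (Fin r) λ j → i ∈ R × j ∈ R × i < j × 𝒬s i j q

A[_] : ∀ {n r} → (Fin n → Fin r) → Subset r → Subset n
A[ part ] R = tabulate λ x → does (part x ∈? R)

-- X is an 𝒜_R-cut: ∅ ≠ X ∩ A_i ≠ A_i for at least two i ∈ R
-- (for R = ⊤ this is an 𝒜-cut)
ProperOn : ∀ {n r} → (Fin n → Fin r) → Subset n → Fin r → Set
ProperOn {n} part X i =
  (Σ (Fin n) λ a → part a ≡ i × a ∈ X) × (Σ (Fin n) λ a → part a ≡ i × a ∉ X)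

IsCutOn : ∀ {n r} → (Fin n → Fin r) → Subset r → Subset n → Set
IsCutOn {r = r} part R X =
  Σ (Fin r) λ i → Σ (Fin r) λ j → i ∈ R × j ∈ R × i ≢ j × ProperOn part X i × ProperOn part X j

Family : ℕ → Set₁
Family n = Subset n → Set

IsCutFamilyOn : ∀ {n r} → (Fin n → Fin r) → Subset r → Family n → Set
IsCutFamilyOn {n} part R 𝓕 = (X : Subset n) → 𝓕 X → IsCutOn part R X

Restrict : ∀ {n r} → (Fin n → Fin r) → Subset r → Family n → Family n
Restrict {n} part R 𝓕 Y =
  Σ (Subset n) λ X → 𝓕 X × Y ≡ X ∩ A[ part ] R × IsCutOn part R (X ∩ A[ part ] R)

Separates : ∀ {n} → Subset n → Fin n → Fin n → Fin n → Fin n → Set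
Separates X a b a' b' = (a ∈ X × b ∈ X × a' ∉ X × b' ∉ X) ⊎ (a ∉ X × b ∉ X × a' ∈ X × b' ∈ X)

DisplaysOn : ∀ {n r} → (Fin n → Fin r) → Subset r → Family n → QuartetSystem n → Set
DisplaysOn {n} {r} part R 𝓕 𝒬 =
  (i j : Fin r) → i ∈ R → j ∈ R → i ≢ j →
  (a a' b b' : Fin n) → part a ≡ i → part a' ≡ i → part b ≡ j → part b' ≡ j →
  a ≢ a' → b ≢ b' →
  (strong a b a' b' ∈Q 𝒬 → Σ (Subset n) λ X → 𝓕 X × Separates X a b a' b')
  × ((Σ (Subset n) λ X → 𝓕 X × Separates X a b a' b') → strong a b a' b' ∈Q 𝒬)

data Path {m : ℕ} (E : Fin m → Fin m → Set) : Fin m → Fin m → List (Fin m) → Set where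
  here : ∀ {u} → Path E u u (u ∷ [])
  step : ∀ {u w v xs} → E u w → Path E w v xs → Path E u (v) (u ∷ xs)

record IsTree {m : ℕ} (E : Fin m → Fin m → Set) : Set where
  field
    irrefl    : ∀ u → ¬ E u u
    symmetric : ∀ u v → E u v → E v u
    connected : ∀ u v → Σ (List (Fin m)) λ xs → Path E u v xs
    acyclic   : ∀ u v xs → Path E u v xs → Unique xs → 3 ≤ length xs → ¬ E v u

record IsPhylogenetic {n m : ℕ} (G : Subset n) (E : Fin m → Fin m → Set) (label : Fin n → Fin m) : Set where
  field
    tree      : IsTree E
    injective : ∀ x y → x ∈ G → y ∈ G → label x ≡ label y → x ≡ y
    -- labelled vertices are leaves (degree ≤ 1)
    leaf      : ∀ x → x ∈ G → ∀ u w → E (label x) u → E (label x) w → u ≡ w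
    internal  : ∀ v → (∀ x → x ∈ G → label x ≢ v) →
                Σ (Fin m) λ u₁ → Σ (Fin m) λ u₂ → Σ (Fin m) λ u₃ →
                  E v u₁ × E v u₂ × E v u₃ × u₁ ≢ u₂ × u₁ ≢ u₃ × u₂ ≢ u₃

TreeDisplays : ∀ {n m} → (Fin m → Fin m → Set) → (Fin n → Fin m) → Quartet n → Set
TreeDisplays {m = m} E label (strong a b c d) =
  ∀ p q → Path E (label a) (label b) p → Unique p → Path E (label c) (label d) q → Unique q →
  (v : Fin m) → LM._∈_ v p → LM._∈_ v q → ⊥
TreeDisplays {m = m} E label (weak a b c d) =
  ∀ p q → Path E (label a) (label b) p → Unique p → Path E (label c) (label d) q → Unique q →
  (v w : Fin m) → LM._∈_ v p → LM._∈_ v q → LM._∈_ w p → LM._∈_ w q → v ≡ w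

CompatibleOn : ∀ {n} → Subset n → QuartetSystem n → Set₁
CompatibleOn {n} G 𝒬 =
  Σ ℕ λ m → Σ (Fin m → Fin m → Set) λ E → Σ (Fin n → Fin m) λ label →
    IsPhylogenetic G E label × ((q : Quartet n) → 𝒬 q → TreeDisplays E label q)

module Submission where

open import Defs
open import Data.Nat using (ℕ; _≤_)
open import Data.Fin using (Fin)
open import Data.Fin.Subset using (Subset; ∣_∣; ⊤)
open import Data.Product using (_×_)

open import Data.Nat using (s≤s; z≤n)
open import Data.Nat.Properties using (≤-trans; ≤-refl; m≤n⇒m≤1+n)
open import Data.Fin using () renaming (zero to fzero; suc to fsuc)
open import Data.Fin.Properties using (_≟_; any?)
open import Data.Fin.Subset using (_∩_) renaming (_∈_ to _∈ₛ_; _∉_ to _∉ₛ_)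
open import Data.Fin.Subset.Properties
  using (∈⊤; Empty-unique; ∣⊥∣≡0; nonempty?; p∩q⊆p; x∈p∩q⁺)
  renaming (_∈?_ to _∈ₛ?_)
open import Data.Product using (Σ; _,_; proj₁; proj₂)
open import Data.Sum using (_⊎_; inj₁; inj₂)
open import Data.Empty using (⊥; ⊥-elim)
open import Data.Unit using (tt) renaming (⊤ to Unit)
open import Data.Bool using (true)
open import Data.List using (List; []; _∷_; length; filter; allFin; lookup; map)
open import Data.List.Membership.Propositional using () renaming (_∈_ to _∈ₗ_; _∉_ to _∉ₗ_)
open import Data.List.Membership.Propositional.Properties
  using (∈-filter⁺; ∈-filter⁻; ∈-lookup; ∈-allFin; ∈-map⁺)
import Data.List.Membership.DecPropositional as DecMembership
open import Data.List.Properties using (length-map)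
open import Data.List.Relation.Unary.Any using (here; there; index)
open import Data.List.Relation.Unary.Any.Properties using (lookup-index)
open import Data.List.Relation.Unary.All using (All; []; _∷_)
open import Data.List.Relation.Unary.All.Properties using (¬Any⇒All¬; all-filter)
open import Data.List.Relation.Unary.AllPairs using ([]; _∷_; tail)
open import Data.List.Relation.Unary.Unique.Propositional using (Unique)
open import Data.List.Relation.Unary.Unique.Propositional.Properties
  using (Unique[x∷xs]⇒x∉xs; filter⁺; allFin⁺; map⁺)
open import Data.Vec.Properties using (lookup∘tabulate; lookup⇒[]=)
open import Relation.Nullary using (¬_; Dec; yes; no; does)
open import Relation.Nullary.Decidable using (¬?; _×-dec_; _⊎-dec_)
open import Relation.Binary.PropositionalEquality
  using (_≡_; _≢_; refl; sym; trans; cong; subst; subst₂)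

-- Every quartet of 𝒬_R has its four corners in A_R, and conversely a
--     quartet of 𝒬 whose corners lie in A_R belongs to 𝒬_R (each 𝒬ᵢⱼ only uses
--     points of A_i ∪ A_j).  A set X separates ab from a'b' for a,a',b,b' ∈ A_R iff
--     X ∩ A_R does, and such a separating X ∩ A_R is automatically an 𝒜_R-cut.
--     So the displaying sets of 𝒬 restrict to displaying sets of 𝒬_R.
-- (2) Compatibility.  We show the general fact that a phylogenetic tree T with leaf
--     set [n] can be restricted to any leaf set G with at least two elements,
--     preserving every quartet with corners in G.  Leaves outside G are deleted
--     one at a time; when a leaf ℓ with neighbour p is deleted, either p still has
--     degree ≥ 3 (just remove ℓ), or p had degree 3 and is suppressed (remove ℓ and
--     p, join the two remaining neighbours).  Intermediate trees live on a subset of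
--     the original vertices ("alive" vertices); at the end the alive vertices are
--     enumerated to obtain a tree on some Fin k.  Paths of the new trees are
--     contained in paths of the old ones, so displayed quartets stay displayed.

∷-unique : ∀ {m} {x : Fin m} {xs} → x ∉ₗ xs → Unique xs → Unique (x ∷ xs)
∷-unique x∉xs u = ¬Any⇒All¬ _ x∉xs ∷ u

_∈ₗ?_ : ∀ {m} (v : Fin m) (xs : List (Fin m)) → Dec (v ∈ₗ xs)
_∈ₗ?_ = DecMembership._∈?_ _≟_

data Consecutive {m : ℕ} (x y : Fin m) : List (Fin m) → Set where
  now   : ∀ {zs} → Consecutive x y (x ∷ y ∷ zs)
  later : ∀ {z zs} → Consecutive x y zs → Consecutive x y (z ∷ zs)

consecutive-fst : ∀ {m} {x y : Fin m} {zs} → Consecutive x y zs → x ∈ₗ zs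
consecutive-fst now       = here refl
consecutive-fst (later c) = there (consecutive-fst c)

consecutive-snd : ∀ {m} {x y : Fin m} {zs} → Consecutive x y zs → y ∈ₗ zs
consecutive-snd now       = there (here refl)
consecutive-snd (later c) = there (consecutive-snd c)

path-nonempty : ∀ {m} {E : Fin m → Fin m → Set} {u v xs} → Path E u v xs → 1 ≤ length xs
path-nonempty here       = s≤s z≤n
path-nonempty (step _ _) = s≤s z≤n

path-cong : ∀ {m} {E : Fin m → Fin m → Set} {a a' b b' xs} →
            a ≡ a' → b ≡ b' → Path E a b xs → Path E a' b' xs
path-cong refl refl P = P

map-path : ∀ {m} {E E' : Fin m → Fin m → Set} → (∀ {a b} → E a b → E' a b) →
           ∀ {u v xs} → Path E u v xs → Path E' u v xs
map-path f here       = here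
map-path f (step e P) = step (f e) (map-path f P)

module Paths {m : ℕ} (E : Fin m → Fin m → Set) where

  start∈ : ∀ {u v xs} → Path E u v xs → u ∈ₗ xs
  start∈ here       = here refl
  start∈ (step _ _) = here refl

  start≡head : ∀ {u v x xs} → Path E u v (x ∷ xs) → u ≡ x
  start≡head here       = refl
  start≡head (step _ _) = refl

  end∈ : ∀ {u v xs} → Path E u v xs → v ∈ₗ xs
  end∈ here       = here refl
  end∈ (step _ P) = there (end∈ P)

  first-edge : ∀ {a b xs} → Path E a b xs → a ≢ b → Σ (Fin m) (E a)
  first-edge here       a≢b = ⊥-elim (a≢b refl)
  first-edge (step e _) _   = _ , e

  suffix : ∀ {w v ys u} → Path E w v ys → Unique ys → u ∈ₗ ys →
           Σ (List (Fin m)) λ zs → Path E u v zs × Unique zs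
  suffix here       U (here refl) = _ , here , U
  suffix (step e P) U (here refl) = _ , step e P , U
  suffix (step e P) U (there i)   = suffix P (tail U) i

  simplify : ∀ {u v xs} → Path E u v xs → Σ (List (Fin m)) λ ys → Path E u v ys × Unique ys
  simplify here = _ , here , ∷-unique (λ ()) []
  simplify {u = u} (step e P) with simplify P
  ... | ys , Q , U with u ∈ₗ? ys
  ...   | yes i = suffix Q U i
  ...   | no u∉ = _ , step e Q , ∷-unique u∉ U

  simple-loop : ∀ {c b ys} → Path E c b ys → Unique ys → c ≡ b → ys ≡ c ∷ []
  simple-loop here       U eq   = refl
  simple-loop (step e P) U refl = ⊥-elim (Unique[x∷xs]⇒x∉xs U (end∈ P))

  consecutive-ends : ∀ {a b xs} → Path E a b xs → Unique xs →
                     Consecutive a b xs ⊎ Consecutive b a xs → length xs ≤ 2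
  consecutive-ends here U _ = s≤s z≤n
  consecutive-ends (step e P) U (inj₁ now) with simple-loop P (tail U) (start≡head P)
  ... | refl = s≤s (s≤s z≤n)
  consecutive-ends (step e P) U (inj₁ (later c)) = ⊥-elim (Unique[x∷xs]⇒x∉xs U (consecutive-fst c))
  consecutive-ends (step e P) U (inj₂ now)       = ⊥-elim (Unique[x∷xs]⇒x∉xs U (here refl))
  consecutive-ends (step e P) U (inj₂ (later c)) = ⊥-elim (Unique[x∷xs]⇒x∉xs U (consecutive-snd c))

  leaf-not-inner : (∀ a b → E a b → E b a) → ∀ ℓ → (∀ a b → E ℓ a → E ℓ b → a ≡ b) →
                   ∀ {a b xs} → Path E a b xs → Unique xs → a ≢ ℓ → b ≢ ℓ → ℓ ∉ₗ xs
  leaf-not-inner sym ℓ leaf here       U a≢ℓ b≢ℓ (here refl) = a≢ℓ refl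
  leaf-not-inner sym ℓ leaf (step e P) U a≢ℓ b≢ℓ (here refl) = a≢ℓ refl
  leaf-not-inner sym ℓ leaf (step {w = w} e P) U a≢ℓ b≢ℓ (there i) with w ≟ ℓ
  ... | no w≢ℓ  = leaf-not-inner sym ℓ leaf P (tail U) w≢ℓ b≢ℓ i
  ... | yes refl = leave P e U b≢ℓ
    where
    -- after entering ℓ the path must leave it again through its only neighbour
    leave : ∀ {a b xs} → Path E ℓ b xs → E a ℓ → Unique (a ∷ xs) → b ≢ ℓ → ⊥
    leave here        _ _ b≢ℓ = b≢ℓ refl
    leave (step e' P) e U _ with leaf _ _ e' (sym _ _ e)
    ... | refl = Unique[x∷xs]⇒x∉xs U (there (start∈ P))

  restrict-path : ∀ {E' : Fin m → Fin m → Set} (P : Fin m → Set) →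
                  (∀ {a b} → E a b → P a → P b → E' a b) →
                  ∀ {u v xs} → Path E u v xs → (∀ z → z ∈ₗ xs → P z) → Path E' u v xs
  restrict-path P f here       h = here
  restrict-path P f (step e Q) h =
    step (f e (h _ (here refl)) (h _ (there (start∈ Q)))) (restrict-path P f Q (λ z i → h z (there i)))

  path-closed : (P : Fin m → Set) → (∀ {a b} → E a b → P b) →
                ∀ {u v xs} → Path E u v xs → P u → ∀ z → z ∈ₗ xs → P z
  path-closed P cl here       pu z (here refl) = pu
  path-closed P cl (step e Q) pu z (here refl) = pu
  path-closed P cl (step e Q) pu z (there i)   = path-closed P cl Q (cl e) z i

Branching : ∀ {m} → (Fin m → Fin m → Set) → Fin m → Set
Branching {m} E v = Σ (Fin m) λ u₁ → Σ (Fin m) λ u₂ → Σ (Fin m) λ u₃ →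
                      E v u₁ × E v u₂ × E v u₃ × u₁ ≢ u₂ × u₁ ≢ u₃ × u₂ ≢ u₃

-- A phylogenetic tree whose vertices are the `Alive` elements of Fin m and whose
-- leaves are labelled by the points satisfying `Leaf`.  Deleting vertices keeps
-- the type Fin m fixed and only shrinks `Alive`; decidability is kept so that the
-- alive vertices can finally be enumerated.
record PhyloOn {n m : ℕ} (Leaf : Fin n → Set) (E : Fin m → Fin m → Set)
               (Alive : Fin m → Set) (label : Fin n → Fin m) : Set where
  field
    alive?          : ∀ v → Dec (Alive v)
    edge?           : ∀ u v → Dec (E u v)
    irrefl          : ∀ u → ¬ E u u
    symmetric       : ∀ u v → E u v → E v u
    edge-alive      : ∀ u v → E u v → Alive u
    connected       : ∀ u v → Alive u → Alive v → Σ (List (Fin m)) λ xs → Path E u v xs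
    acyclic         : ∀ u v xs → Path E u v xs → Unique xs → 3 ≤ length xs → ¬ E v u
    label-alive     : ∀ x → Leaf x → Alive (label x)
    label-injective : ∀ x y → Leaf x → Leaf y → label x ≡ label y → x ≡ y
    leaf            : ∀ x → Leaf x → ∀ u w → E (label x) u → E (label x) w → u ≡ w
    internal        : ∀ v → Alive v → (∀ x → Leaf x → label x ≢ v) → Branching E v

Corners : ∀ {n} → (Fin n → Set) → Quartet n → Set
Corners P (strong a b c d) = P a × P b × P c × P d
Corners P (weak a b c d)   = P a × P b × P c × P d

corners-map : ∀ {n} {P P' : Fin n → Set} → (∀ t → P t → P' t) → ∀ q → Corners P q → Corners P' q
corners-map f (strong a b c d) (pa , pb , pc , pd) = f a pa , f b pb , f c pc , f d pd
corners-map f (weak a b c d)   (pa , pb , pc , pd) = f a pa , f b pb , f c pc , f d pd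

display-transfer :
  ∀ {n m} {E E' : Fin m → Fin m → Set} {label : Fin n → Fin m} (P : Fin m → Set) →
  (∀ {a b xs} → Path E' a b xs → Unique xs → P a →
     Σ (List (Fin m)) λ ys → Path E a b ys × Unique ys × (∀ v → v ∈ₗ xs → v ∈ₗ ys)) →
  ∀ q → Corners (λ t → P (label t)) q → TreeDisplays E label q → TreeDisplays E' label q
display-transfer P cover (strong a b c d) (pa , _ , pc , _) D _ _ Pab Uab Pcd Ucd v v∈ab v∈cd
  with cover Pab Uab pa | cover Pcd Ucd pc
... | ys , Q , UQ , ⊆ys | zs , Q' , UQ' , ⊆zs =
  D ys zs Q UQ Q' UQ' v (⊆ys v v∈ab) (⊆zs v v∈cd)
display-transfer P cover (weak a b c d) (pa , _ , pc , _) D _ _ Pab Uab Pcd Ucd v w v∈ab v∈cd w∈ab w∈cd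
  with cover Pab Uab pa | cover Pcd Ucd pc
... | ys , Q , UQ , ⊆ys | zs , Q' , UQ' , ⊆zs =
  D ys zs Q UQ Q' UQ' v w (⊆ys v v∈ab) (⊆zs v v∈cd) (⊆ys w w∈ab) (⊆zs w w∈cd)

-- adjacency in a tree is decidable: u, v are adjacent iff their simple path is u v
tree-edge? : ∀ {m} {E : Fin m → Fin m → Set} → IsTree E → ∀ u v → Dec (E u v)
tree-edge? {E = E} T u v with u ≟ v
... | yes refl = no (IsTree.irrefl T u)
... | no u≢v with Paths.simplify E (proj₂ (IsTree.connected T u v))
... | _  , here , _                = ⊥-elim (u≢v refl)
... | _  , step e here , _         = yes e
... | ys , step e (step e' P) , U  =
  no λ e'' → IsTree.acyclic T u v ys (step e (step e' P)) U (s≤s (s≤s (path-nonempty P)))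
               (IsTree.symmetric T u v e'')

phylo-on-all : ∀ {n m} {E : Fin m → Fin m → Set} {label : Fin n → Fin m} →
               IsPhylogenetic ⊤ E label → PhyloOn (λ _ → Unit) E (λ _ → Unit) label
phylo-on-all {E = E} Ph = record
  { alive?          = λ _ → yes tt
  ; edge?           = tree-edge? tree
  ; irrefl          = irrefl
  ; symmetric       = symmetric
  ; edge-alive      = λ _ _ _ → tt
  ; connected       = λ u v _ _ → connected u v
  ; acyclic         = acyclic
  ; label-alive     = λ _ _ → tt
  ; label-injective = λ x y _ _ → injective x y ∈⊤ ∈⊤
  ; leaf            = λ x _ → leaf x ∈⊤
  ; internal        = λ v _ unl → internal v (λ x _ → unl x tt)
  }
  where
  open IsPhylogenetic Ph
  open IsTree tree

-- Deleting one labelled leaf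

Deleted : ∀ {n m} (Leaf' : Fin n → Set) (E : Fin m → Fin m → Set) (label : Fin n → Fin m) → Set₁
Deleted {n} {m} Leaf' E label =
  Σ (Fin m → Fin m → Set) λ E' → Σ (Fin m → Set) λ Alive' → PhyloOn Leaf' E' Alive' label ×
    (∀ q → Corners Leaf' q → TreeDisplays E label q → TreeDisplays E' label q)

module DeleteLeaf {n m : ℕ} {Leaf : Fin n → Set} {E : Fin m → Fin m → Set} {Alive : Fin m → Set}
                  {label : Fin n → Fin m} (T : PhyloOn Leaf E Alive label)
                  (x : Fin n) (leaf-x : Leaf x) (y z : Fin n) (leaf-y : Leaf y) (leaf-z : Leaf z)
                  (y≢x : y ≢ x) (z≢x : z ≢ x) (y≢z : y ≢ z) where
  open PhyloOn T
  open Paths E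

  ℓ : Fin m
  ℓ = label x

  Leaf' : Fin n → Set
  Leaf' t = Leaf t × t ≢ x

  label≢ℓ : ∀ t → Leaf t → t ≢ x → label t ≢ ℓ
  label≢ℓ t leaf-t t≢x eq = t≢x (label-injective t x leaf-t leaf-x eq)

  -- ℓ has a neighbour p (it is not the only vertex, as label y ≢ ℓ) ...
  neighbour : Σ (Fin m) (E ℓ)
  neighbour = first-edge (proj₂ (connected ℓ (label y) (label-alive x leaf-x) (label-alive y leaf-y)))
                         (λ eq → label≢ℓ y leaf-y y≢x (sym eq))

  p : Fin m
  p = proj₁ neighbour

  ℓ—p : E ℓ p
  ℓ—p = proj₂ neighbour

  only-p : ∀ a → E ℓ a → a ≡ p
  only-p a e = leaf x leaf-x a p e ℓ—p

  p≢ℓ : p ≢ ℓ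
  p≢ℓ eq = irrefl ℓ (subst (E ℓ) eq ℓ—p)

  alive-p : Alive p
  alive-p = edge-alive p ℓ (symmetric ℓ p ℓ—p)

  -- If p were the leaf label t, a leaf s ∉ {x, t} could not be reached from ℓ:
  -- the simple path ℓ p … would have to return to ℓ, the only neighbour of t.
  p-not-label-of : ∀ t → Leaf t → label t ≡ p → ∀ s → Leaf s → s ≢ x → s ≢ t → ⊥
  p-not-label-of t leaf-t lt≡p s leaf-s s≢x s≢t
    with simplify (proj₂ (connected ℓ (label s) (label-alive x leaf-x) (label-alive s leaf-s)))
  ... | _ , P , U = walk P refl refl U
    where
    walk : ∀ {a b ys} → Path E a b ys → a ≡ ℓ → b ≡ label s → Unique ys → ⊥
    walk here a≡ℓ b≡s U = label≢ℓ s leaf-s s≢x (trans (sym b≡s) a≡ℓ)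
    walk (step e here) refl b≡s U =
      s≢t (label-injective s t leaf-s leaf-t (trans (sym b≡s) (trans (only-p _ e) (sym lt≡p))))
    walk (step {w = w₁} e (step {w = w₂} e' P)) refl b≡s U with only-p w₁ e
    ... | refl with leaf t leaf-t w₂ ℓ (subst (λ k → E k w₂) (sym lt≡p) e')
                                      (subst (λ k → E k ℓ) (sym lt≡p) (symmetric ℓ p ℓ—p))
    ... | refl = Unique[x∷xs]⇒x∉xs U (there (start∈ P))

  p-unlabelled : ∀ t → Leaf t → label t ≢ p
  p-unlabelled t leaf-t eq with t ≟ x
  ... | yes refl = p≢ℓ (sym eq)
  ... | no t≢x with y ≟ t
  ...   | yes refl = p-not-label-of t leaf-t eq z leaf-z z≢x (λ e → y≢z (sym e))
  ...   | no y≢t   = p-not-label-of t leaf-t eq y leaf-y y≢x y≢t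

  OtherNeighbours : Set
  OtherNeighbours = Σ (Fin m) λ u → Σ (Fin m) λ w → E p u × E p w × u ≢ ℓ × w ≢ ℓ × u ≢ w

  other-neighbours : OtherNeighbours
  other-neighbours with internal p alive-p p-unlabelled
  ... | u₁ , u₂ , u₃ , e₁ , e₂ , e₃ , d₁₂ , d₁₃ , d₂₃ with u₁ ≟ ℓ
  ...   | yes refl = u₂ , u₃ , e₂ , e₃ , (λ q → d₁₂ (sym q)) , (λ q → d₁₃ (sym q)) , d₂₃
  ...   | no u₁≢ℓ with u₂ ≟ ℓ
  ...     | yes refl = u₁ , u₃ , e₁ , e₃ , u₁≢ℓ , (λ q → d₂₃ (sym q)) , d₁₃
  ...     | no u₂≢ℓ  = u₁ , u₂ , e₁ , e₂ , u₁≢ℓ , u₂≢ℓ , d₁₂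

  unlabelled-before : ∀ v → v ≢ ℓ → (∀ t → Leaf' t → label t ≢ v) → ∀ t → Leaf t → label t ≢ v
  unlabelled-before v v≢ℓ unl t leaf-t with t ≟ x
  ... | yes refl = λ eq → v≢ℓ (sym eq)
  ... | no t≢x   = unl t (leaf-t , t≢x)

  ≢p⇒nbr≢ℓ : ∀ {v v'} → E v v' → v ≢ p → v' ≢ ℓ
  ≢p⇒nbr≢ℓ {v} e v≢p refl = v≢p (only-p v (symmetric _ _ e))

  -- Case 1: p has a third neighbour s ∉ {ℓ, u, w}; remove ℓ, p keeps degree ≥ 3.
  module Prune (u w s : Fin m) (p—u : E p u) (p—w : E p w) (p—s : E p s)
               (u≢ℓ : u ≢ ℓ) (w≢ℓ : w ≢ ℓ) (s≢ℓ : s ≢ ℓ) (u≢w : u ≢ w) (s≢u : s ≢ u) (s≢w : s ≢ w) where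
    E' : Fin m → Fin m → Set
    E' a b = E a b × a ≢ ℓ × b ≢ ℓ

    Alive' : Fin m → Set
    Alive' v = Alive v × v ≢ ℓ

    -- simple paths avoiding ℓ at their ends avoid ℓ altogether
    connected' : ∀ a b → Alive' a → Alive' b → Σ (List (Fin m)) λ xs → Path E' a b xs
    connected' a b (alive-a , a≢ℓ) (alive-b , b≢ℓ) with simplify (proj₂ (connected a b alive-a alive-b))
    ... | ys , P , U = ys , restrict-path (_≢ ℓ) (λ e a≢ b≢ → e , a≢ , b≢) P
                              (λ v v∈ v≡ℓ → leaf-not-inner symmetric ℓ (leaf x leaf-x) P U a≢ℓ b≢ℓ
                                              (subst (_∈ₗ ys) v≡ℓ v∈))

    internal' : ∀ v → Alive' v → (∀ t → Leaf' t → label t ≢ v) → Branching E' v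
    internal' v (alive-v , v≢ℓ) unl with v ≟ p
    ... | yes refl = u , w , s , (p—u , p≢ℓ , u≢ℓ) , (p—w , p≢ℓ , w≢ℓ) , (p—s , p≢ℓ , s≢ℓ) ,
                     u≢w , (λ q → s≢u (sym q)) , (λ q → s≢w (sym q))
    ... | no v≢p with internal v alive-v (unlabelled-before v v≢ℓ unl)
    ... | n₁ , n₂ , n₃ , e₁ , e₂ , e₃ , d₁₂ , d₁₃ , d₂₃ =
      n₁ , n₂ , n₃ , (e₁ , v≢ℓ , ≢p⇒nbr≢ℓ e₁ v≢p) , (e₂ , v≢ℓ , ≢p⇒nbr≢ℓ e₂ v≢p) ,
      (e₃ , v≢ℓ , ≢p⇒nbr≢ℓ e₃ v≢p) , d₁₂ , d₁₃ , d₂₃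

    tree : PhyloOn Leaf' E' Alive' label
    tree = record
      { alive?          = λ v → alive? v ×-dec ¬? (v ≟ ℓ)
      ; edge?           = λ a b → edge? a b ×-dec (¬? (a ≟ ℓ) ×-dec ¬? (b ≟ ℓ))
      ; irrefl          = λ a e → irrefl a (proj₁ e)
      ; symmetric       = λ { a b (e , a≢ , b≢) → symmetric a b e , b≢ , a≢ }
      ; edge-alive      = λ { a b (e , a≢ , _) → edge-alive a b e , a≢ }
      ; connected       = connected'
      ; acyclic         = λ a b xs P U len e → acyclic a b xs (map-path proj₁ P) U len (proj₁ e)
      ; label-alive     = λ { t (leaf-t , t≢x) → label-alive t leaf-t , label≢ℓ t leaf-t t≢x }
      ; label-injective = λ { t t' (leaf-t , _) (leaf-t' , _) → label-injective t t' leaf-t leaf-t' }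
      ; leaf            = λ { t (leaf-t , _) a b (e₁ , _) (e₂ , _) → leaf t leaf-t a b e₁ e₂ }
      ; internal        = internal'
      }

    result : Deleted Leaf' E label
    result = E' , Alive' , tree ,
             λ q c → display-transfer (λ _ → Unit) old-path q (corners-map (λ _ _ → tt) q c)
      where
      old-path : ∀ {a b xs} → Path E' a b xs → Unique xs → Unit →
                 Σ (List (Fin m)) λ ys → Path E a b ys × Unique ys × (∀ v → v ∈ₗ xs → v ∈ₗ ys)
      old-path {xs = xs} P U _ = xs , map-path proj₁ P , U , λ _ i → i

  -- Case 2: the neighbours of p are exactly ℓ, u, w; remove ℓ and p and join u—w.
  module Suppress (u w : Fin m) (p—u : E p u) (p—w : E p w) (u≢w : u ≢ w) (u≢ℓ : u ≢ ℓ) (w≢ℓ : w ≢ ℓ)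
                  (neighbours-p : ∀ s → E p s → s ≡ ℓ ⊎ s ≡ u ⊎ s ≡ w) where
    NewEdge : Fin m → Fin m → Set
    NewEdge a b = (a ≡ u × b ≡ w) ⊎ (a ≡ w × b ≡ u)

    E' : Fin m → Fin m → Set
    E' a b = (E a b × a ≢ ℓ × b ≢ ℓ × a ≢ p × b ≢ p) ⊎ NewEdge a b

    Alive' : Fin m → Set
    Alive' v = Alive v × v ≢ ℓ × v ≢ p

    u≢p : u ≢ p
    u≢p refl = irrefl p p—u

    w≢p : w ≢ p
    w≢p refl = irrefl p p—w

    alive-u : Alive' u
    alive-u = edge-alive u p (symmetric p u p—u) , u≢ℓ , u≢p

    alive-w : Alive' w
    alive-w = edge-alive w p (symmetric p w p—w) , w≢ℓ , w≢p

    -- u and w were not adjacent: u p w would close a triangle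
    u≁w : ¬ E u w
    u≁w e = acyclic u w (u ∷ p ∷ w ∷ []) (step (symmetric p u p—u) (step p—w here)) upw-unique
                    (s≤s (s≤s (s≤s z≤n))) (symmetric u w e)
      where
      upw-unique : Unique (u ∷ p ∷ w ∷ [])
      upw-unique = ∷-unique (λ { (here q) → u≢p q ; (there (here q)) → u≢w q ; (there (there ())) })
                     (∷-unique (λ { (here q) → w≢p (sym q) ; (there ()) }) (∷-unique (λ ()) []))

    new-edge-irrefl : ∀ {a} → ¬ NewEdge a a
    new-edge-irrefl (inj₁ (refl , q)) = u≢w q
    new-edge-irrefl (inj₂ (refl , q)) = u≢w (sym q)

    new-edge-to-p : ∀ {a b} → NewEdge a b → E a p
    new-edge-to-p (inj₁ (refl , _)) = symmetric p u p—u
    new-edge-to-p (inj₂ (refl , _)) = symmetric p w p—w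

    new-edge-from-p : ∀ {a b} → NewEdge a b → E p b
    new-edge-from-p (inj₁ (_ , refl)) = p—w
    new-edge-from-p (inj₂ (_ , refl)) = p—u

    new-edge-functional : ∀ {v a b} → NewEdge v a → NewEdge v b → a ≡ b
    new-edge-functional (inj₁ (_ , a≡w))  (inj₁ (_ , b≡w))  = trans a≡w (sym b≡w)
    new-edge-functional (inj₁ (v≡u , _))  (inj₂ (v≡w , _))  = ⊥-elim (u≢w (trans (sym v≡u) v≡w))
    new-edge-functional (inj₂ (v≡w , _))  (inj₁ (v≡u , _))  = ⊥-elim (u≢w (trans (sym v≡u) v≡w))
    new-edge-functional (inj₂ (_ , a≡u))  (inj₂ (_ , b≡u))  = trans a≡u (sym b≡u)

    symmetric' : ∀ a b → E' a b → E' b a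
    symmetric' a b (inj₁ (e , a≢ℓ , b≢ℓ , a≢p , b≢p)) = inj₁ (symmetric a b e , b≢ℓ , a≢ℓ , b≢p , a≢p)
    symmetric' a b (inj₂ (inj₁ (a≡u , b≡w)))          = inj₂ (inj₂ (b≡w , a≡u))
    symmetric' a b (inj₂ (inj₂ (a≡w , b≡u)))          = inj₂ (inj₁ (b≡u , a≡w))

    edge-alive' : ∀ a b → E' a b → Alive' a
    edge-alive' a b (inj₁ (e , a≢ℓ , _ , a≢p , _)) = edge-alive a b e , a≢ℓ , a≢p
    edge-alive' a b (inj₂ (inj₁ (refl , _)))       = alive-u
    edge-alive' a b (inj₂ (inj₂ (refl , _)))       = alive-w

    path-avoids-p : ∀ {a b xs} → Path E' a b xs → Alive' a → ∀ v → v ∈ₗ xs → v ≢ p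
    path-avoids-p P alive-a v v∈ =
      proj₂ (proj₂ (Paths.path-closed E' Alive' (λ {a} {b} e → edge-alive' b a (symmetric' a b e))
                                      P alive-a v v∈))

    UWConsecutive : List (Fin m) → Set
    UWConsecutive xs = Consecutive u w xs ⊎ Consecutive w u xs

    uw∈ : ∀ {xs} → UWConsecutive xs → u ∈ₗ xs × w ∈ₗ xs
    uw∈ (inj₁ c) = consecutive-fst c , consecutive-snd c
    uw∈ (inj₂ c) = consecutive-snd c , consecutive-fst c

    uw-later : ∀ {a xs} → UWConsecutive xs → UWConsecutive (a ∷ xs)
    uw-later (inj₁ c) = inj₁ (later c)
    uw-later (inj₂ c) = inj₂ (later c)

    uw-now : ∀ {a c b zs} → NewEdge a c → Path E' c b zs → UWConsecutive (a ∷ zs)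
    uw-now (inj₁ (refl , refl)) here       = inj₁ now
    uw-now (inj₁ (refl , refl)) (step _ _) = inj₁ now
    uw-now (inj₂ (refl , refl)) here       = inj₂ now
    uw-now (inj₂ (refl , refl)) (step _ _) = inj₂ now

    new-edge-start∈ : ∀ {a c xs} → NewEdge a c → u ∈ₗ xs × w ∈ₗ xs → a ∈ₗ xs
    new-edge-start∈ (inj₁ (refl , _)) (u∈ , _) = u∈
    new-edge-start∈ (inj₂ (refl , _)) (_ , w∈) = w∈

    within-cons : ∀ {a v xs} → v ∈ₗ xs ⊎ v ≡ p → v ∈ₗ (a ∷ xs) ⊎ v ≡ p
    within-cons (inj₁ i) = inj₁ (there i)
    within-cons (inj₂ q) = inj₂ q

    -- A simple path xs of the new tree, expanded to a simple path of the old tree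
    -- by inserting p into every new edge u—w.
    record Expansion (a b : Fin m) (xs : List (Fin m)) : Set where
      field
        vertices   : List (Fin m)
        path       : Path E a b vertices
        unique     : Unique vertices
        covers     : ∀ v → v ∈ₗ xs → v ∈ₗ vertices
        within     : ∀ v → v ∈ₗ vertices → v ∈ₗ xs ⊎ v ≡ p
        p-inserted : p ∈ₗ vertices → UWConsecutive xs
        longer     : length xs ≤ length vertices

    fresh-start : ∀ {a xs ys} → Unique (a ∷ xs) → a ≢ p → (∀ v → v ∈ₗ ys → v ∈ₗ xs ⊎ v ≡ p) → a ∉ₗ ys
    fresh-start U a≢p within a∈ with within _ a∈
    ... | inj₁ a∈xs = Unique[x∷xs]⇒x∉xs U a∈xs
    ... | inj₂ a≡p  = a≢p a≡p

    expand : ∀ {a b xs} → Path E' a b xs → Unique xs → (∀ v → v ∈ₗ xs → v ≢ p) → Expansion a b xs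
    expand {a} here U avoid = record
      { vertices = a ∷ [] ; path = here ; unique = U ; covers = λ _ i → i ; within = λ _ i → inj₁ i
      ; p-inserted = λ { (here q) → ⊥-elim (avoid a (here refl) (sym q)) ; (there ()) }
      ; longer = ≤-refl }
    expand {a} (step (inj₁ (e , _)) P) U avoid = record
      { vertices   = a ∷ vertices
      ; path       = step e path
      ; unique     = ∷-unique (fresh-start U a≢p within) unique
      ; covers     = λ { v (here q) → here q ; v (there i) → there (covers v i) }
      ; within     = λ { v (here q) → inj₁ (here q) ; v (there i) → within-cons (within v i) }
      ; p-inserted = λ { (here q) → ⊥-elim (a≢p (sym q)) ; (there i) → uw-later (p-inserted i) }
      ; longer     = s≤s longer }
      where
      open Expansion (expand P (tail U) (λ v i → avoid v (there i)))
      a≢p : a ≢ p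
      a≢p = avoid a (here refl)
    expand {a} (step {w = c} (inj₂ new) P) U avoid = record
      { vertices   = a ∷ p ∷ vertices
      ; path       = step (new-edge-to-p new) (step (new-edge-from-p new) path)
      ; unique     = ∷-unique a∉ (∷-unique p∉ unique)
      ; covers     = λ { v (here q) → here q ; v (there i) → there (there (covers v i)) }
      ; within     = λ { v (here q) → inj₁ (here q) ; v (there (here q)) → inj₂ q
                       ; v (there (there i)) → within-cons (within v i) }
      ; p-inserted = λ _ → uw-now new P
      ; longer     = s≤s (m≤n⇒m≤1+n longer) }
      where
      open Expansion (expand P (tail U) (λ v i → avoid v (there i)))
      a≢p : a ≢ p
      a≢p = avoid a (here refl)
      a∉ : a ∉ₗ (p ∷ vertices)
      a∉ (here a≡p) = a≢p a≡p
      a∉ (there i)  = fresh-start U a≢p within i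
      -- p in the rest would force u, w into the rest, but a ∈ {u, w} starts the path
      p∉ : p ∉ₗ vertices
      p∉ i = Unique[x∷xs]⇒x∉xs U (new-edge-start∈ new (uw∈ (p-inserted i)))

    new-edge : ∀ a d → (a ≡ ℓ ⊎ a ≡ u ⊎ a ≡ w) → (d ≡ ℓ ⊎ d ≡ u ⊎ d ≡ w) →
               a ≢ ℓ → d ≢ ℓ → a ≢ d → NewEdge a d
    new-edge a d (inj₁ a≡ℓ) _ a≢ℓ _ _ = ⊥-elim (a≢ℓ a≡ℓ)
    new-edge a d _ (inj₁ d≡ℓ) _ d≢ℓ _ = ⊥-elim (d≢ℓ d≡ℓ)
    new-edge a d (inj₂ (inj₁ refl)) (inj₂ (inj₁ refl)) _ _ a≢d = ⊥-elim (a≢d refl)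
    new-edge a d (inj₂ (inj₁ refl)) (inj₂ (inj₂ refl)) _ _ _   = inj₁ (refl , refl)
    new-edge a d (inj₂ (inj₂ refl)) (inj₂ (inj₁ refl)) _ _ _   = inj₂ (refl , refl)
    new-edge a d (inj₂ (inj₂ refl)) (inj₂ (inj₂ refl)) _ _ a≢d = ⊥-elim (a≢d refl)

    -- an old simple path avoiding ℓ, with ends ≢ p, becomes a new path by
    -- replacing a passage a p d through p by the new edge a—d
    shortcut : ∀ {a b ys} → Path E a b ys → Unique ys → (∀ v → v ∈ₗ ys → v ≢ ℓ) → a ≢ p → b ≢ p →
               Σ (List (Fin m)) λ zs → Path E' a b zs
    shortcut here U avoid a≢p b≢p = _ , here
    shortcut {a} (step {w = c} e P) U avoid a≢p b≢p with c ≟ p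
    ... | no c≢p = _ , step (inj₁ (e , avoid a (here refl) , avoid c (there (start∈ P)) , a≢p , c≢p))
                            (proj₂ (shortcut P (tail U) (λ v i → avoid v (there i)) c≢p b≢p))
    ... | yes refl = through-p P refl (tail U) (λ v i → avoid v (there i)) b≢p (Unique[x∷xs]⇒x∉xs U)
      where
      through-p : ∀ {c' b' zs} → Path E c' b' zs → c' ≡ p → Unique zs → (∀ v → v ∈ₗ zs → v ≢ ℓ) →
                  b' ≢ p → a ∉ₗ zs → Σ (List (Fin m)) λ zs' → Path E' a b' zs'
      through-p here refl _ _ b'≢p _ = ⊥-elim (b'≢p refl)
      through-p (step {w = d} p—d P') refl U' avoid' b'≢p a∉ =
        _ , step (inj₂ (new-edge a d (neighbours-p a (symmetric a p e)) (neighbours-p d p—d)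
                                     (avoid a (here refl)) (avoid' d (there (start∈ P')))
                                     (λ a≡d → a∉ (there (subst (_∈ₗ _) (sym a≡d) (start∈ P'))))))
                 (proj₂ (shortcut P' (tail U') (λ v i → avoid' v (there i)) d≢p b'≢p))
        where
        d≢p : d ≢ p
        d≢p refl = irrefl p p—d

    connected' : ∀ a b → Alive' a → Alive' b → Σ (List (Fin m)) λ xs → Path E' a b xs
    connected' a b (alive-a , a≢ℓ , a≢p) (alive-b , b≢ℓ , b≢p)
      with simplify (proj₂ (connected a b alive-a alive-b))
    ... | ys , P , U = shortcut P U (λ v i v≡ℓ → leaf-not-inner symmetric ℓ (leaf x leaf-x) P U a≢ℓ b≢ℓ
                                                    (subst (_∈ₗ ys) v≡ℓ i)) a≢p b≢p

    -- A cycle of the new tree expands to a cycle of the old tree; if its closing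
    -- edge is a new one and p already lies on the expanded path, the cycle was
    -- just u w, which is too short.
    acyclic' : ∀ a b xs → Path E' a b xs → Unique xs → 3 ≤ length xs → ¬ E' b a
    acyclic' a b xs P U 3≤ e' = close e'
      where
      open Expansion (expand P U (path-avoids-p P (edge-alive' a b (symmetric' b a e'))))
      ends-consecutive : ∀ {a b xs} → NewEdge b a → UWConsecutive xs → Consecutive a b xs ⊎ Consecutive b a xs
      ends-consecutive (inj₁ (refl , refl)) (inj₁ c) = inj₂ c
      ends-consecutive (inj₁ (refl , refl)) (inj₂ c) = inj₁ c
      ends-consecutive (inj₂ (refl , refl)) (inj₁ c) = inj₁ c
      ends-consecutive (inj₂ (refl , refl)) (inj₂ c) = inj₂ c
      close : E' b a → ⊥
      close (inj₁ (e , _)) = acyclic a b vertices path unique (≤-trans 3≤ longer) e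
      close (inj₂ new) with p ∈ₗ? vertices
      ... | yes p∈ = 3≰2 (≤-trans 3≤ (Paths.consecutive-ends E' P U (ends-consecutive new (p-inserted p∈))))
        where
        3≰2 : ¬ 3 ≤ 2
        3≰2 (s≤s (s≤s ()))
      ... | no p∉ = acyclic p b (p ∷ vertices) (step (new-edge-from-p new) path) (∷-unique p∉ unique)
                            (≤-trans 3≤ (m≤n⇒m≤1+n longer)) (new-edge-to-p new)

    -- a leaf of the old tree stays a leaf: it cannot have both an old edge to a
    -- vertex ≢ p and a new edge (which requires an old edge to p)
    leaf' : ∀ v → (∀ a b → E v a → E v b → a ≡ b) → ∀ a b → E' v a → E' v b → a ≡ b
    leaf' v leaf-v a b (inj₁ (e₁ , _)) (inj₁ (e₂ , _))            = leaf-v a b e₁ e₂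
    leaf' v leaf-v a b (inj₁ (e₁ , _ , _ , _ , a≢p)) (inj₂ new)   = ⊥-elim (a≢p (leaf-v a p e₁ (new-edge-to-p new)))
    leaf' v leaf-v a b (inj₂ new) (inj₁ (e₂ , _ , _ , _ , b≢p))   = ⊥-elim (b≢p (leaf-v b p e₂ (new-edge-to-p new)))
    leaf' v leaf-v a b (inj₂ new₁) (inj₂ new₂)                     = new-edge-functional new₁ new₂

    -- The old neighbour n of v is replaced by the new neighbour n'': itself if n ≢ p,
    -- and otherwise (v ∈ {u, w}) the other one of u, w, which is not an old neighbour.
    Replacement : Fin m → Fin m → Fin m → Set
    Replacement v n n'' = E' v n'' × (n ≢ p → n'' ≡ n) × (n ≡ p → ¬ E v n'')

    replace : ∀ v → v ≢ ℓ → v ≢ p → ∀ n → E v n → Σ (Fin m) (Replacement v n)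
    replace v v≢ℓ v≢p n e with n ≟ p
    ... | no n≢p = n , inj₁ (e , v≢ℓ , ≢p⇒nbr≢ℓ e v≢p , v≢p , n≢p) , (λ _ → refl) , (λ n≡p → ⊥-elim (n≢p n≡p))
    ... | yes refl with neighbours-p v (symmetric v p e)
    ...   | inj₁ v≡ℓ         = ⊥-elim (v≢ℓ v≡ℓ)
    ...   | inj₂ (inj₁ refl) = w , inj₂ (inj₁ (refl , refl)) , (λ p≢p → ⊥-elim (p≢p refl)) , (λ _ → u≁w)
    ...   | inj₂ (inj₂ refl) = u , inj₂ (inj₂ (refl , refl)) , (λ p≢p → ⊥-elim (p≢p refl)) ,
                                 (λ _ e' → u≁w (symmetric w u e'))

    replacements-distinct : ∀ {v n₁ n₂ m₁ m₂} → n₁ ≢ n₂ → E v n₁ → E v n₂ →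
                            Replacement v n₁ m₁ → Replacement v n₂ m₂ → m₁ ≢ m₂
    replacements-distinct {v} {n₁} {n₂} n₁≢n₂ e₁ e₂ (_ , keep₁ , fresh₁) (_ , keep₂ , fresh₂) m₁≡m₂
      with n₁ ≟ p | n₂ ≟ p
    ... | yes n₁≡p | yes n₂≡p = n₁≢n₂ (trans n₁≡p (sym n₂≡p))
    ... | yes n₁≡p | no n₂≢p  = fresh₁ n₁≡p (subst (E v) (sym (trans m₁≡m₂ (keep₂ n₂≢p))) e₂)
    ... | no n₁≢p  | yes n₂≡p = fresh₂ n₂≡p (subst (E v) (trans (sym (keep₁ n₁≢p)) m₁≡m₂) e₁)
    ... | no n₁≢p  | no n₂≢p  = n₁≢n₂ (trans (sym (keep₁ n₁≢p)) (trans m₁≡m₂ (keep₂ n₂≢p)))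

    internal' : ∀ v → Alive' v → (∀ t → Leaf' t → label t ≢ v) → Branching E' v
    internal' v (alive-v , v≢ℓ , v≢p) unl with internal v alive-v (unlabelled-before v v≢ℓ unl)
    ... | n₁ , n₂ , n₃ , e₁ , e₂ , e₃ , d₁₂ , d₁₃ , d₂₃
      with replace v v≢ℓ v≢p n₁ e₁ | replace v v≢ℓ v≢p n₂ e₂ | replace v v≢ℓ v≢p n₃ e₃
    ... | m₁ , r₁ | m₂ , r₂ | m₃ , r₃ =
      m₁ , m₂ , m₃ , proj₁ r₁ , proj₁ r₂ , proj₁ r₃ ,
      replacements-distinct d₁₂ e₁ e₂ r₁ r₂ , replacements-distinct d₁₃ e₁ e₃ r₁ r₃ ,
      replacements-distinct d₂₃ e₂ e₃ r₂ r₃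

    label-alive' : ∀ t → Leaf' t → Alive' (label t)
    label-alive' t (leaf-t , t≢x) = label-alive t leaf-t , label≢ℓ t leaf-t t≢x , p-unlabelled t leaf-t

    tree : PhyloOn Leaf' E' Alive' label
    tree = record
      { alive?          = λ v → alive? v ×-dec (¬? (v ≟ ℓ) ×-dec ¬? (v ≟ p))
      ; edge?           = λ a b → (edge? a b ×-dec (¬? (a ≟ ℓ) ×-dec (¬? (b ≟ ℓ) ×-dec
                                     (¬? (a ≟ p) ×-dec ¬? (b ≟ p)))))
                                  ⊎-dec (((a ≟ u) ×-dec (b ≟ w)) ⊎-dec ((a ≟ w) ×-dec (b ≟ u)))
      ; irrefl          = λ { a (inj₁ (e , _)) → irrefl a e ; a (inj₂ new) → new-edge-irrefl new }
      ; symmetric       = symmetric'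
      ; edge-alive      = edge-alive'
      ; connected       = connected'
      ; acyclic         = acyclic'
      ; label-alive     = label-alive'
      ; label-injective = λ { t t' (leaf-t , _) (leaf-t' , _) → label-injective t t' leaf-t leaf-t' }
      ; leaf            = λ { t (leaf-t , _) → leaf' (label t) (leaf t leaf-t) }
      ; internal        = internal'
      }

    result : Deleted Leaf' E label
    result = E' , Alive' , tree ,
             λ q c → display-transfer Alive' old-path q (corners-map label-alive' q c)
      where
      old-path : ∀ {a b xs} → Path E' a b xs → Unique xs → Alive' a →
                 Σ (List (Fin m)) λ ys → Path E a b ys × Unique ys × (∀ v → v ∈ₗ xs → v ∈ₗ ys)
      old-path P U alive-a = vertices , path , unique , covers
        where open Expansion (expand P U (path-avoids-p P alive-a))

  -- p has degree ≥ 4 (prune) or exactly 3 (suppress)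
  result : Deleted Leaf' E label
  result with other-neighbours
  ... | u , w , p—u , p—w , u≢ℓ , w≢ℓ , u≢w
    with any? (λ s → edge? p s ×-dec (¬? (s ≟ ℓ) ×-dec (¬? (s ≟ u) ×-dec ¬? (s ≟ w))))
  ... | yes (s , p—s , s≢ℓ , s≢u , s≢w) = Prune.result u w s p—u p—w p—s u≢ℓ w≢ℓ s≢ℓ u≢w s≢u s≢w
  ... | no no-fourth = Suppress.result u w p—u p—w u≢w u≢ℓ w≢ℓ neighbours-p
    where
    neighbours-p : ∀ s → E p s → s ≡ ℓ ⊎ s ≡ u ⊎ s ≡ w
    neighbours-p s e with s ≟ ℓ | s ≟ u | s ≟ w
    ... | yes s≡ℓ | _ | _               = inj₁ s≡ℓ
    ... | no _ | yes s≡u | _            = inj₂ (inj₁ s≡u)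
    ... | no _ | no _ | yes s≡w         = inj₂ (inj₂ s≡w)
    ... | no s≢ℓ | no s≢u | no s≢w      = ⊥-elim (no-fourth (s , e , s≢ℓ , s≢u , s≢w))

-- Deleting all leaves outside a set G

Kept : ∀ {n} → List (Fin n) → Fin n → Set
Kept []      t = Unit
Kept (x ∷ L) t = Kept L t × t ≢ x

∉⇒kept : ∀ {n} {t : Fin n} L → t ∉ₗ L → Kept L t
∉⇒kept []      t∉L = tt
∉⇒kept (x ∷ L) t∉L = ∉⇒kept L (λ i → t∉L (there i)) , λ t≡x → t∉L (here t≡x)

kept⇒∉ : ∀ {n} {t : Fin n} L → Kept L t → t ∉ₗ L
kept⇒∉ (x ∷ L) (_ , t≢x)    (here t≡x) = t≢x t≡x
kept⇒∉ (x ∷ L) (kept , _)   (there i)  = kept⇒∉ L kept i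

module DeleteOutside {n m : ℕ} {E₀ : Fin m → Fin m → Set} {label : Fin n → Fin m}
                     (T₀ : PhyloOn (λ _ → Unit) E₀ (λ _ → Unit) label) (G : Subset n)
                     {y z : Fin n} (y∈G : y ∈ₛ G) (z∈G : z ∈ₛ G) (y≢z : y ≢ z) where

  ∈G⇒≢ : ∀ {t x} → x ∉ₛ G → t ∈ₛ G → t ≢ x
  ∈G⇒≢ x∉G t∈G t≡x = x∉G (subst (_∈ₛ G) t≡x t∈G)

  G⇒kept : ∀ {t} L → All (_∉ₛ G) L → t ∈ₛ G → Kept L t
  G⇒kept []      _           t∈G = tt
  G⇒kept (x ∷ L) (x∉G ∷ out) t∈G = G⇒kept L out t∈G , ∈G⇒≢ x∉G t∈G

  -- delete the points of L one by one; y and z, lying in G, always survive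
  delete-all : ∀ L → Unique L → All (_∉ₛ G) L → Deleted (Kept L) E₀ label
  delete-all [] _ _ = E₀ , (λ _ → Unit) , T₀ , λ _ _ D → D
  delete-all (x ∷ L) U (x∉G ∷ out) with delete-all L (tail U) out
  ... | E , Alive , T , D with DeleteLeaf.result T x (∉⇒kept L (Unique[x∷xs]⇒x∉xs U)) y z
                                 (G⇒kept L out y∈G) (G⇒kept L out z∈G) (∈G⇒≢ x∉G y∈G) (∈G⇒≢ x∉G z∈G) y≢z
  ... | E' , Alive' , T' , D' =
    E' , Alive' , T' , λ q c d → D' q c (D q (corners-map (λ _ → proj₁) q c) d)

  outside : List (Fin n)
  outside = filter (λ t → ¬? (t ∈ₛ? G)) (allFin n)

  kept⇔G : (∀ t → t ∈ₛ G → Kept outside t) × (∀ t → Kept outside t → t ∈ₛ G)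
  kept⇔G = (λ t → G⇒kept outside (all-filter _ (allFin n))) , kept⇒G
    where
    kept⇒G : ∀ t → Kept outside t → t ∈ₛ G
    kept⇒G t kept with t ∈ₛ? G
    ... | yes t∈G = t∈G
    ... | no t∉G  = ⊥-elim (kept⇒∉ outside kept (∈-filter⁺ (λ t → ¬? (t ∈ₛ? G)) (∈-allFin t) t∉G))

  result : Deleted (Kept outside) E₀ label
  result = delete-all outside (filter⁺ _ (allFin⁺ n)) (all-filter _ (allFin n))

-- Renumbering the alive vertices as Fin k

lookup-injective : ∀ {m} {xs : List (Fin m)} → Unique xs → ∀ i j → lookup xs i ≡ lookup xs j → i ≡ j
lookup-injective {xs = x ∷ xs} U fzero    fzero    eq = refl
lookup-injective {xs = x ∷ xs} U fzero    (fsuc j) eq = ⊥-elim (Unique[x∷xs]⇒x∉xs U (subst (_∈ₗ xs) (sym eq) (∈-lookup j)))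
lookup-injective {xs = x ∷ xs} U (fsuc i) fzero    eq = ⊥-elim (Unique[x∷xs]⇒x∉xs U (subst (_∈ₗ xs) eq (∈-lookup i)))
lookup-injective {xs = x ∷ xs} U (fsuc i) (fsuc j) eq = cong fsuc (lookup-injective (tail U) i j eq)

module Enumerate {n m : ℕ} {Leaf : Fin n → Set} {E : Fin m → Fin m → Set} {Alive : Fin m → Set}
                 {label : Fin n → Fin m} (T : PhyloOn Leaf E Alive label) (G : Subset n)
                 (G⇒leaf : ∀ t → t ∈ₛ G → Leaf t) (leaf⇒G : ∀ t → Leaf t → t ∈ₛ G)
                 (x₀ : Fin n) (leaf-x₀ : Leaf x₀) where
  open PhyloOn T

  alive-list : List (Fin m)
  alive-list = filter alive? (allFin m)

  k : ℕ
  k = length alive-list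

  emb : Fin k → Fin m
  emb = lookup alive-list

  emb-injective : ∀ {i j} → emb i ≡ emb j → i ≡ j
  emb-injective {i} {j} = lookup-injective (filter⁺ alive? (allFin⁺ m)) i j

  emb-alive : ∀ i → Alive (emb i)
  emb-alive i = proj₂ (∈-filter⁻ alive? {xs = allFin m} (∈-lookup i))

  number : ∀ v → Alive v → Fin k
  number v a = index (∈-filter⁺ alive? (∈-allFin v) a)

  emb-number : ∀ v a → emb (number v a) ≡ v
  emb-number v a = sym (lookup-index (∈-filter⁺ alive? (∈-allFin v) a))

  -- labels of non-leaves are irrelevant; send them to the label of x₀
  number-label : (t : Fin n) → Dec (Alive (label t)) → Fin k
  number-label t (yes a) = number (label t) a
  number-label t (no _)  = number (label x₀) (label-alive x₀ leaf-x₀)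

  label'' : Fin n → Fin k
  label'' t = number-label t (alive? (label t))

  emb-label : ∀ t → Leaf t → emb (label'' t) ≡ label t
  emb-label t leaf-t with alive? (label t)
  ... | yes a = emb-number (label t) a
  ... | no ¬a = ⊥-elim (¬a (label-alive t leaf-t))

  E'' : Fin k → Fin k → Set
  E'' i j = E (emb i) (emb j)

  push : ∀ {i j xs} → Path E'' i j xs → Path E (emb i) (emb j) (map emb xs)
  push here       = here
  push (step e P) = step e (push P)

  pull : ∀ {a b ys} → Path E a b ys → ∀ i j → emb i ≡ a → emb j ≡ b → Σ (List (Fin k)) (Path E'' i j)
  pull here i j i≡a j≡b with emb-injective (trans i≡a (sym j≡b))
  ... | refl = _ , here
  pull {a} (step {w = c} e P) i j i≡a j≡b =
    _ , step (subst₂ E (sym i≡a) (sym (emb-number c alive-c)) e)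
             (proj₂ (pull P (number c alive-c) j (emb-number c alive-c) j≡b))
    where
    alive-c : Alive c
    alive-c = edge-alive c a (symmetric a c e)

  map-unique : ∀ {xs} → Unique xs → Unique (map emb xs)
  map-unique = map⁺ emb-injective

  is-tree : IsTree E''
  is-tree = record
    { irrefl    = λ u → irrefl (emb u)
    ; symmetric = λ u v → symmetric (emb u) (emb v)
    ; connected = λ u v → pull (proj₂ (connected (emb u) (emb v) (emb-alive u) (emb-alive v))) u v refl refl
    ; acyclic   = λ u v xs P U len e → acyclic (emb u) (emb v) (map emb xs) (push P) (map-unique U)
                    (subst (3 ≤_) (sym (length-map emb xs)) len) e
    }

  internal'' : ∀ v → (∀ x → x ∈ₛ G → label'' x ≢ v) → Branching E'' v
  internal'' v unl with internal (emb v) (emb-alive v)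
                             (λ t leaf-t eq → unl t (leaf⇒G t leaf-t) (emb-injective (trans (emb-label t leaf-t) eq)))
  ... | n₁ , n₂ , n₃ , e₁ , e₂ , e₃ , d₁₂ , d₁₃ , d₂₃ =
    number n₁ a₁ , number n₂ a₂ , number n₃ a₃ ,
    subst (E (emb v)) (sym (emb-number n₁ a₁)) e₁ ,
    subst (E (emb v)) (sym (emb-number n₂ a₂)) e₂ ,
    subst (E (emb v)) (sym (emb-number n₃ a₃)) e₃ ,
    (λ q → d₁₂ (trans (sym (emb-number n₁ a₁)) (trans (cong emb q) (emb-number n₂ a₂)))) ,
    (λ q → d₁₃ (trans (sym (emb-number n₁ a₁)) (trans (cong emb q) (emb-number n₃ a₃)))) ,
    (λ q → d₂₃ (trans (sym (emb-number n₂ a₂)) (trans (cong emb q) (emb-number n₃ a₃))))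
    where
    a₁ = edge-alive n₁ (emb v) (symmetric _ _ e₁)
    a₂ = edge-alive n₂ (emb v) (symmetric _ _ e₂)
    a₃ = edge-alive n₃ (emb v) (symmetric _ _ e₃)

  phylogenetic : IsPhylogenetic G E'' label''
  phylogenetic = record
    { tree      = is-tree
    ; injective = λ x y x∈G y∈G eq →
        label-injective x y (G⇒leaf x x∈G) (G⇒leaf y y∈G)
          (trans (sym (emb-label x (G⇒leaf x x∈G))) (trans (cong emb eq) (emb-label y (G⇒leaf y y∈G))))
    ; leaf      = λ x x∈G u w e₁ e₂ → emb-injective (leaf x (G⇒leaf x x∈G) (emb u) (emb w)
                    (subst (λ c → E c (emb u)) (emb-label x (G⇒leaf x x∈G)) e₁)
                    (subst (λ c → E c (emb w)) (emb-label x (G⇒leaf x x∈G)) e₂))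
    ; internal  = internal''
    }

  push-labelled : ∀ {a b xs} → Leaf a → Leaf b → Path E'' (label'' a) (label'' b) xs →
                  Path E (label a) (label b) (map emb xs)
  push-labelled leaf-a leaf-b P = path-cong (emb-label _ leaf-a) (emb-label _ leaf-b) (push P)

  displays : ∀ q → Corners Leaf q → TreeDisplays E label q → TreeDisplays E'' label'' q
  displays (strong a b c d) (la , lb , lc , ld) D xs ys Pxs Uxs Pys Uys v v∈xs v∈ys =
    D (map emb xs) (map emb ys) (push-labelled la lb Pxs) (map-unique Uxs)
      (push-labelled lc ld Pys) (map-unique Uys) (emb v) (∈-map⁺ emb v∈xs) (∈-map⁺ emb v∈ys)
  displays (weak a b c d) (la , lb , lc , ld) D xs ys Pxs Uxs Pys Uys v w v∈xs v∈ys w∈xs w∈ys =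
    emb-injective (D (map emb xs) (map emb ys) (push-labelled la lb Pxs) (map-unique Uxs)
      (push-labelled lc ld Pys) (map-unique Uys) (emb v) (emb w)
      (∈-map⁺ emb v∈xs) (∈-map⁺ emb v∈ys) (∈-map⁺ emb w∈xs) (∈-map⁺ emb w∈ys))

restrict-compatible : ∀ {n} (G : Subset n) {y z : Fin n} → y ∈ₛ G → z ∈ₛ G → y ≢ z →
                      (𝒬 𝒬' : QuartetSystem n) → (∀ q → 𝒬' q → 𝒬 q × Corners (_∈ₛ G) q) →
                      CompatibleOn ⊤ 𝒬 → CompatibleOn G 𝒬'
restrict-compatible G y∈G z∈G y≢z _ 𝒬' sub (_ , _ , _ , Ph , D₀)
  with DeleteOutside.result (phylo-on-all Ph) G y∈G z∈G y≢z
... | E , Alive , T , D = k , E'' , label'' , phylogenetic , displays'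
  where
  open DeleteOutside (phylo-on-all Ph) G y∈G z∈G y≢z using (outside; kept⇔G)
  open Enumerate T G (proj₁ kept⇔G) (proj₂ kept⇔G) _ (proj₁ kept⇔G _ y∈G)
  displays' : ∀ q → 𝒬' q → TreeDisplays E'' label'' q
  displays' q q∈ = displays q kept (D q kept (D₀ q (proj₁ (sub q q∈))))
    where
    kept : Corners (Kept outside) q
    kept = corners-map (proj₁ kept⇔G) q (proj₂ (sub q q∈))

corners-variant : ∀ {n} {P : Fin n → Set} q₀ q → q ∈ₗ variants q₀ → Corners P q₀ → Corners P q
corners-variant (strong a b c d) _ (here refl) (pa , pb , pc , pd) = pa , pb , pc , pd
corners-variant (strong a b c d) _ (there (here refl)) (pa , pb , pc , pd) = pb , pa , pc , pd
corners-variant (strong a b c d) _ (there (there (here refl))) (pa , pb , pc , pd) = pa , pb , pd , pc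
corners-variant (strong a b c d) _ (there (there (there (here refl)))) (pa , pb , pc , pd) = pb , pa , pd , pc
corners-variant (strong a b c d) _ (there (there (there (there (here refl))))) (pa , pb , pc , pd) = pc , pd , pa , pb
corners-variant (strong a b c d) _ (there (there (there (there (there (here refl)))))) (pa , pb , pc , pd) = pd , pc , pa , pb
corners-variant (strong a b c d) _ (there (there (there (there (there (there (here refl))))))) (pa , pb , pc , pd) = pc , pd , pb , pa
corners-variant (strong a b c d) _ (there (there (there (there (there (there (there (here refl)))))))) (pa , pb , pc , pd) = pd , pc , pb , pa
corners-variant (weak a b c d) _ (here refl) (pa , pb , pc , pd) = pa , pb , pc , pd
corners-variant (weak a b c d) _ (there (here refl)) (pa , pb , pc , pd) = pb , pa , pc , pd
corners-variant (weak a b c d) _ (there (there (here refl))) (pa , pb , pc , pd) = pa , pb , pd , pc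
corners-variant (weak a b c d) _ (there (there (there (here refl)))) (pa , pb , pc , pd) = pb , pa , pd , pc
corners-variant (weak a b c d) _ (there (there (there (there (here refl))))) (pa , pb , pc , pd) = pc , pd , pa , pb
corners-variant (weak a b c d) _ (there (there (there (there (there (here refl)))))) (pa , pb , pc , pd) = pd , pc , pa , pb
corners-variant (weak a b c d) _ (there (there (there (there (there (there (here refl))))))) (pa , pb , pc , pd) = pc , pd , pb , pa
corners-variant (weak a b c d) _ (there (there (there (there (there (there (there (here refl)))))))) (pa , pb , pc , pd) = pd , pc , pb , pa

corners-variant⁻ : ∀ {n} {P : Fin n → Set} q₀ q → q ∈ₗ variants q₀ → Corners P q → Corners P q₀
corners-variant⁻ (strong a b c d) _ (here refl) (p₁ , p₂ , p₃ , p₄) = p₁ , p₂ , p₃ , p₄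
corners-variant⁻ (strong a b c d) _ (there (here refl)) (p₁ , p₂ , p₃ , p₄) = p₂ , p₁ , p₃ , p₄
corners-variant⁻ (strong a b c d) _ (there (there (here refl))) (p₁ , p₂ , p₃ , p₄) = p₁ , p₂ , p₄ , p₃
corners-variant⁻ (strong a b c d) _ (there (there (there (here refl)))) (p₁ , p₂ , p₃ , p₄) = p₂ , p₁ , p₄ , p₃
corners-variant⁻ (strong a b c d) _ (there (there (there (there (here refl))))) (p₁ , p₂ , p₃ , p₄) = p₃ , p₄ , p₁ , p₂
corners-variant⁻ (strong a b c d) _ (there (there (there (there (there (here refl)))))) (p₁ , p₂ , p₃ , p₄) = p₃ , p₄ , p₂ , p₁
corners-variant⁻ (strong a b c d) _ (there (there (there (there (there (there (here refl))))))) (p₁ , p₂ , p₃ , p₄) = p₄ , p₃ , p₁ , p₂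
corners-variant⁻ (strong a b c d) _ (there (there (there (there (there (there (there (here refl)))))))) (p₁ , p₂ , p₃ , p₄) = p₄ , p₃ , p₂ , p₁
corners-variant⁻ (weak a b c d) _ (here refl) (p₁ , p₂ , p₃ , p₄) = p₁ , p₂ , p₃ , p₄
corners-variant⁻ (weak a b c d) _ (there (here refl)) (p₁ , p₂ , p₃ , p₄) = p₂ , p₁ , p₃ , p₄
corners-variant⁻ (weak a b c d) _ (there (there (here refl))) (p₁ , p₂ , p₃ , p₄) = p₁ , p₂ , p₄ , p₃
corners-variant⁻ (weak a b c d) _ (there (there (there (here refl)))) (p₁ , p₂ , p₃ , p₄) = p₂ , p₁ , p₄ , p₃
corners-variant⁻ (weak a b c d) _ (there (there (there (there (here refl))))) (p₁ , p₂ , p₃ , p₄) = p₃ , p₄ , p₁ , p₂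
corners-variant⁻ (weak a b c d) _ (there (there (there (there (there (here refl)))))) (p₁ , p₂ , p₃ , p₄) = p₃ , p₄ , p₂ , p₁
corners-variant⁻ (weak a b c d) _ (there (there (there (there (there (there (here refl))))))) (p₁ , p₂ , p₃ , p₄) = p₄ , p₃ , p₁ , p₂
corners-variant⁻ (weak a b c d) _ (there (there (there (there (there (there (there (here refl)))))))) (p₁ , p₂ , p₃ , p₄) = p₄ , p₃ , p₂ , p₁

A-member⁺ : ∀ {n r} (part : Fin n → Fin r) (R : Subset r) {x} → part x ∈ₛ R → x ∈ₛ A[ part ] R
A-member⁺ part R {x} h = lookup⇒[]= x _ (trans (lookup∘tabulate _ x) (does-true (part x ∈ₛ? R) h))
  where
  does-true : ∀ {P : Set} (d : Dec P) → P → does d ≡ true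
  does-true (yes _) _ = refl
  does-true (no ¬p) p = ⊥-elim (¬p p)

inhabited : ∀ {r} (R : Subset r) → 2 ≤ ∣ R ∣ → Σ (Fin r) (_∈ₛ R)
inhabited {r} R 2≤∣R∣ with nonempty? R
... | yes ne = ne
... | no ¬ne with subst (2 ≤_) (trans (cong ∣_∣ (Empty-unique ¬ne)) (∣⊥∣≡0 r)) 2≤∣R∣
... | ()

bipartite-corners : ∀ {n r} {part : Fin n → Fin r} {i j 𝒬} → CompleteBipartite part i j 𝒬 →
                    ∀ q → 𝒬 q → (P : Fin n → Set) →
                    (∀ t → part t ≡ i → P t) → (∀ t → part t ≡ j → P t) → Corners P q
bipartite-corners cb q q∈ P Pᵢ Pⱼ with proj₂ cb q q∈
... | α , α' , β , β' , pα , pα' , pβ , pβ' , _ , _ , inj₁ v =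
  corners-variant (strong α β α' β') q v (Pᵢ α pα , Pⱼ β pβ , Pᵢ α' pα' , Pⱼ β' pβ')
... | α , α' , β , β' , pα , pα' , pβ , pβ' , _ , _ , inj₂ (inj₁ v) =
  corners-variant (strong α β' α' β) q v (Pᵢ α pα , Pⱼ β' pβ' , Pᵢ α' pα' , Pⱼ β pβ)
... | α , α' , β , β' , pα , pα' , pβ , pβ' , _ , _ , inj₂ (inj₂ v) =
  corners-variant (weak α α' β β') q v (Pᵢ α pα , Pᵢ α' pα' , Pⱼ β pβ , Pⱼ β' pβ')

bipartite-meets : ∀ {n r} {part : Fin n → Fin r} {i j 𝒬} → CompleteBipartite part i j 𝒬 →
                  ∀ q → 𝒬 q → (P : Fin n → Set) → Corners P q →
                  (Σ (Fin n) λ t → part t ≡ i × P t) × (Σ (Fin n) λ t → part t ≡ j × P t)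
bipartite-meets cb q q∈ P c with proj₂ cb q q∈
... | α , α' , β , β' , pα , _ , pβ , _ , _ , _ , inj₁ v
  with corners-variant⁻ (strong α β α' β') q v c
...   | Pα , Pβ , _ = (α , pα , Pα) , (β , pβ , Pβ)
bipartite-meets cb q q∈ P c | α , α' , β , β' , pα , _ , _ , pβ' , _ , _ , inj₂ (inj₁ v)
  with corners-variant⁻ (strong α β' α' β) q v c
...   | Pα , Pβ' , _ = (α , pα , Pα) , (β' , pβ' , Pβ')
bipartite-meets cb q q∈ P c | α , α' , β , β' , pα , _ , pβ , _ , _ , _ , inj₂ (inj₂ v)
  with corners-variant⁻ (weak α α' β β') q v c
...   | Pα , _ , Pβ , _ = (α , pα , Pα) , (β , pβ , Pβ)

module Union {n r : ℕ} (part : Fin n → Fin r) (𝒬s : Fin r → Fin r → QuartetSystem n)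
             (complete : CompletePartiteFamily part 𝒬s) (R : Subset r) where

  block-in-R : ∀ {t i} → part t ≡ i → i ∈ₛ R → part t ∈ₛ R
  block-in-R eq i∈R = subst (_∈ₛ R) (sym eq) i∈R

  union-corners : ∀ q → UnionOn R 𝒬s q → Corners (λ t → part t ∈ₛ R) q
  union-corners q (i , j , i∈R , j∈R , i<j , q∈) =
    bipartite-corners (complete i j i<j) q q∈ _ (λ _ eq → block-in-R eq i∈R) (λ _ eq → block-in-R eq j∈R)

  union-⊆ : ∀ q → UnionOn R 𝒬s q → UnionOn ⊤ 𝒬s q
  union-⊆ q (i , j , _ , _ , i<j , q∈) = i , j , ∈⊤ , ∈⊤ , i<j , q∈

  union-restrict : ∀ q → UnionOn ⊤ 𝒬s q → Corners (λ t → part t ∈ₛ R) q → UnionOn R 𝒬s q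
  union-restrict q (i , j , _ , _ , i<j , q∈) c with bipartite-meets (complete i j i<j) q q∈ _ c
  ... | (_ , eqᵢ , i∈R) , (_ , eqⱼ , j∈R) =
    i , j , subst (_∈ₛ R) eqᵢ i∈R , subst (_∈ₛ R) eqⱼ j∈R , i<j , q∈

separates-∩ : ∀ {n} {X S : Subset n} {a b a' b'} → a ∈ₛ S → b ∈ₛ S → a' ∈ₛ S → b' ∈ₛ S →
              Separates X a b a' b' → Separates (X ∩ S) a b a' b'
separates-∩ {X = X} {S} a∈ b∈ a'∈ b'∈ (inj₁ (a∈X , b∈X , a'∉X , b'∉X)) =
  inj₁ (x∈p∩q⁺ (a∈X , a∈) , x∈p∩q⁺ (b∈X , b∈) , (λ h → a'∉X (p∩q⊆p X S h)) , (λ h → b'∉X (p∩q⊆p X S h)))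
separates-∩ {X = X} {S} a∈ b∈ a'∈ b'∈ (inj₂ (a∉X , b∉X , a'∈X , b'∈X)) =
  inj₂ ((λ h → a∉X (p∩q⊆p X S h)) , (λ h → b∉X (p∩q⊆p X S h)) , x∈p∩q⁺ (a'∈X , a'∈) , x∈p∩q⁺ (b'∈X , b'∈))

separates-∩⁻ : ∀ {n} {X S : Subset n} {a b a' b'} → a ∈ₛ S → b ∈ₛ S → a' ∈ₛ S → b' ∈ₛ S →
               Separates (X ∩ S) a b a' b' → Separates X a b a' b'
separates-∩⁻ {X = X} {S} a∈ b∈ a'∈ b'∈ (inj₁ (a∈X , b∈X , a'∉X , b'∉X)) =
  inj₁ (p∩q⊆p X S a∈X , p∩q⊆p X S b∈X , (λ h → a'∉X (x∈p∩q⁺ (h , a'∈))) , (λ h → b'∉X (x∈p∩q⁺ (h , b'∈))))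
separates-∩⁻ {X = X} {S} a∈ b∈ a'∈ b'∈ (inj₂ (a∉X , b∉X , a'∈X , b'∈X)) =
  inj₂ ((λ h → a∉X (x∈p∩q⁺ (h , a∈))) , (λ h → b∉X (x∈p∩q⁺ (h , b∈))) , p∩q⊆p X S a'∈X , p∩q⊆p X S b'∈X)

separating-cut : ∀ {n r} {part : Fin n → Fin r} {R : Subset r} {Y : Subset n} {i j a a' b b'} →
                 i ∈ₛ R → j ∈ₛ R → i ≢ j → part a ≡ i → part a' ≡ i → part b ≡ j → part b' ≡ j →
                 Separates Y a b a' b' → IsCutOn part R Y
separating-cut {i = i} {j} {a} {a'} {b} {b'} i∈R j∈R i≢j pa pa' pb pb' (inj₁ (a∈ , b∈ , a'∉ , b'∉)) =
  i , j , i∈R , j∈R , i≢j , ((a , pa , a∈) , (a' , pa' , a'∉)) , ((b , pb , b∈) , (b' , pb' , b'∉))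
separating-cut {i = i} {j} {a} {a'} {b} {b'} i∈R j∈R i≢j pa pa' pb pb' (inj₂ (a∉ , b∉ , a'∈ , b'∈)) =
  i , j , i∈R , j∈R , i≢j , ((a' , pa' , a'∈) , (a , pa , a∉)) , ((b' , pb' , b'∈) , (b , pb , b∉))

restrict-displays : ∀ {n r} (part : Fin n → Fin r) (𝒬s : Fin r → Fin r → QuartetSystem n) →
                    CompletePartiteFamily part 𝒬s → (R : Subset r) (𝓕 : Family n) →
                    DisplaysOn part ⊤ 𝓕 (UnionOn ⊤ 𝒬s) → DisplaysOn part R (Restrict part R 𝓕) (UnionOn R 𝒬s)
restrict-displays {n} part 𝒬s complete R 𝓕 displays i j i∈R j∈R i≢j a a' b b' pa pa' pb pb' a≢a' b≢b' =
  to-restricted , from-restricted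
  where
  open Union part 𝒬s complete R
  D = displays i j ∈⊤ ∈⊤ i≢j a a' b b' pa pa' pb pb' a≢a' b≢b'
  A = A[ part ] R
  in-R : Corners (λ t → part t ∈ₛ R) (strong a b a' b')
  in-R = block-in-R pa i∈R , block-in-R pb j∈R , block-in-R pa' i∈R , block-in-R pb' j∈R
  a∈ = A-member⁺ part R (proj₁ in-R)
  b∈ = A-member⁺ part R (proj₁ (proj₂ in-R))
  a'∈ = A-member⁺ part R (proj₁ (proj₂ (proj₂ in-R)))
  b'∈ = A-member⁺ part R (proj₂ (proj₂ (proj₂ in-R)))

  to-restricted : strong a b a' b' ∈Q UnionOn R 𝒬s →
                  Σ (Subset n) λ Y → Restrict part R 𝓕 Y × Separates Y a b a' b'
  to-restricted (q , v , q∈) with proj₁ D (q , v , union-⊆ q q∈)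
  ... | X , X∈𝓕 , sep = X ∩ A , (X , X∈𝓕 , refl , separating-cut i∈R j∈R i≢j pa pa' pb pb' sep∩) , sep∩
    where sep∩ = separates-∩ a∈ b∈ a'∈ b'∈ sep

  from-restricted : (Σ (Subset n) λ Y → Restrict part R 𝓕 Y × Separates Y a b a' b') →
                    strong a b a' b' ∈Q UnionOn R 𝒬s
  from-restricted (_ , (X , X∈𝓕 , refl , _) , sep) with proj₂ D (X , X∈𝓕 , separates-∩⁻ a∈ b∈ a'∈ b'∈ sep)
  ... | q , v , q∈ = q , v , union-restrict q q∈ (corners-variant (strong a b a' b') q v in-R)

restrict-partite-compatible :
  ∀ {n r} (part : Fin n → Fin r) → BlocksAtLeast2 part → (𝒬s : Fin r → Fin r → QuartetSystem n) →
  CompletePartiteFamily part 𝒬s → (R : Subset r) → 2 ≤ ∣ R ∣ →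
  CompatibleOn ⊤ (UnionOn ⊤ 𝒬s) → CompatibleOn (A[ part ] R) (UnionOn R 𝒬s)
restrict-partite-compatible part blocks 𝒬s complete R 2≤∣R∣ with inhabited R 2≤∣R∣
... | i , i∈R with blocks i
... | y , z , y≢z , py , pz =
  restrict-compatible (A[ part ] R) (A-member⁺ part R (block-in-R py i∈R))
    (A-member⁺ part R (block-in-R pz i∈R)) y≢z _ _
    (λ q q∈ → union-⊆ q q∈ , corners-map (λ t → A-member⁺ part R) q (union-corners q q∈))
  where open Union part 𝒬s complete R

lemma2p6 : (n r : ℕ) (part : Fin n → Fin r) → BlocksAtLeast2 part →
           (𝒬s : Fin r → Fin r → QuartetSystem n) → CompletePartiteFamily part 𝒬s →
           (𝓕 : Family n) → IsCutFamilyOn part ⊤ 𝓕 →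
           (R : Subset r) → 2 ≤ ∣ R ∣ →
           (DisplaysOn part ⊤ 𝓕 (UnionOn ⊤ 𝒬s) →
             DisplaysOn part R (Restrict part R 𝓕) (UnionOn R 𝒬s))
           × (CompatibleOn ⊤ (UnionOn ⊤ 𝒬s) → CompatibleOn (A[ part ] R) (UnionOn R 𝒬s))
lemma2p6 n r part blocks 𝒬s complete 𝓕 _ R 2≤∣R∣ =
  restrict-displays part 𝒬s complete R 𝓕 , restrict-partite-compatible part blocks 𝒬s complete R 2≤∣R∣
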